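{- Let $k\ge3$ be odd, and let $A\subseteq\mathbb{N}$ with $\min(A)=0$, $\max(A)\le k$ and $A\subsetneq[k]$. Then $F_k=\{0,(k+1)/2\}$ is an additive divisor of $[k]$, and $F_k\notin F(B)$ for every additive divisor $B$ of $A$.
   Context: $\mathbb{N}=\{0,1,2,\ldots\}$, $[k]=\{0,1,\ldots,k\}$, and $X+Y=\{x+y:x\in X,y\in Y\}$. A set $B\subseteq\mathbb{N}$ is an additive divisor of a set $E$ if $B+C=E$ for some $C\subseteq\mathbb{N}$. For sets $X,Y\subseteq\mathbb{N}$ with $X+Y=A$, define (relative to $k$ and $A$) the promotion $Y_X=Y\cup\{s\in[k]\setminus A:s<\max(X)\}\cup\{s-\max(X):s\in[k]\setminus A,\ s\ge\max(X)\}$. For an additive divisor $B$ of $A$, $F(B)$ is the collection of sets consisting of: $B$ itself, provided there exists $C\subseteq\mathbb{N}$ with $B+C=A$ and $\max(B)\le\max(C)$; and $B_C$ for every $C\subseteq\mathbb{N}$ with $B+C=A$ and $\max(C)\le\max(B)$. -}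

module Defs where

open import Level using (0ℓ)
open import Data.Nat using (ℕ; _+_; _∸_; _≤_; _<_; _/_; suc)
open import Data.Product using (Σ; ∃; _×_; _,_)
open import Data.Sum using (_⊎_)
open import Relation.Nullary using (¬_)
open import Relation.Unary using (Pred; _≐_)
open import Relation.Binary.PropositionalEquality using (_≡_)

SetN : Set₁
SetN = Pred ℕ 0ℓ

_⊕_ : SetN → SetN → SetN
(X ⊕ Y) n = Σ ℕ λ x → Σ ℕ λ y → X x × Y y × x + y ≡ n

Upto : ℕ → SetN
Upto k n = n ≤ k

IsMax : SetN → ℕ → Set
IsMax X m = X m × (∀ x → X x → x ≤ m)

AdditiveDivisor : SetN → SetN → Set₁
AdditiveDivisor B E = Σ SetN λ C → (B ⊕ C) ≐ E

-- Promotion Y_X relative to k and A, where m = max(X):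
-- Y ∪ {s ∈ [k]∖A : s < m} ∪ {s − m : s ∈ [k]∖A, s ≥ m}
Promotion : ℕ → SetN → SetN → ℕ → SetN
Promotion k A Y m n =
  Y n
  ⊎ (n ≤ k × ¬ A n × n < m)
  ⊎ (Σ ℕ λ s → s ≤ k × ¬ A s × m ≤ s × n ≡ s ∸ m)

-- S ∈ F(B) (relative to k and A), membership up to extensional set equality.
InF : ℕ → SetN → SetN → SetN → Set₁
InF k A B S =
  ((S ≐ B) × (Σ SetN λ C → (B ⊕ C) ≐ A × Σ ℕ λ mB → Σ ℕ λ mC →
      IsMax B mB × IsMax C mC × mB ≤ mC))
  ⊎ (Σ SetN λ C → (B ⊕ C) ≐ A × Σ ℕ λ mB → Σ ℕ λ mC →
      IsMax B mB × IsMax C mC × mC ≤ mB × (S ≐ Promotion k A B mC))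

Fk : ℕ → SetN
Fk k n = (n ≡ 0) ⊎ (n ≡ suc k / 2)

-- The sumset {0, h} + {0, …, h − 1} tiles [k] when 2h = k + 1, so F_k divides [k].
-- Suppose F_k ∈ F(B) with B + C = A, b = max B and c = max C.
-- If F_k = B and b ≤ c, then h + c ∈ A although h + c ≥ 2h > k.
-- If F_k = B_C with c ≤ b, then b ∈ B_C = {0, h}.  For b = 0 we get A = {0}, so
-- 1 ∈ [k] ∖ A is promoted to 1 ∈ F_k, impossible since h ≥ 2.  For b = h, every
-- s ∈ [k] ∖ A is promoted to 0 or h: s < c gives s = 0 ∈ A or s = h ≥ c, and s ≥ c
-- gives s = c = 0 + c ∈ A or s = h + c ∈ A.  So A = [k], a contradiction; as A need not
-- be decidable, this last step is carried out under double negation.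
module Submission where

open import Defs
open import Data.Nat using (ℕ; zero; suc; _+_; _*_; _∸_; _≤_; _<_; _/_; _%_; z≤n; s≤s; _<?_)
open import Data.Nat.Properties
open import Data.Nat.DivMod using (%-distribˡ-+; m/n*n≡m; /-monoˡ-≤)
open import Data.Nat.Divisibility using (_∣_; m%n≡0⇒n∣m)
open import Data.Product using (_×_; _,_; proj₁; proj₂)
open import Data.Sum using (_⊎_; inj₁; inj₂)
open import Function using (_∘_; case_of_)
open import Relation.Nullary using (¬_; yes; no)
open import Relation.Unary using (_≐_; _⊆_)
open import Relation.Binary.PropositionalEquality using (_≡_; refl; sym; trans; cong; subst; module ≡-Reasoning)

half+half≡suc : ∀ {k} → k % 2 ≡ 1 → suc k / 2 + suc k / 2 ≡ suc k
half+half≡suc {k} k-odd = begin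
  suc k / 2 + suc k / 2        ≡⟨ cong (suc k / 2 +_) (sym (+-identityʳ _)) ⟩
  2 * (suc k / 2)              ≡⟨ *-comm 2 (suc k / 2) ⟩
  suc k / 2 * 2                ≡⟨ m/n*n≡m 2∣suc-k ⟩
  suc k                        ∎
  where
  open ≡-Reasoning
  2∣suc-k : 2 ∣ suc k
  2∣suc-k = m%n≡0⇒n∣m (suc k) 2 (trans (%-distribˡ-+ 1 k 2) (cong (λ r → (1 + r) % 2) k-odd))

2≤half : ∀ {k} → 3 ≤ k → 2 ≤ suc k / 2
2≤half 3≤k = /-monoˡ-≤ 2 (s≤s 3≤k)

¬¬-∀≤ : (P : ℕ → Set) (k : ℕ) → (∀ s → s ≤ k → ¬ ¬ P s) → ¬ ¬ (∀ s → s ≤ k → P s)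
¬¬-∀≤ P zero    ¬¬P ¬∀P = ¬¬P 0 z≤n λ P0 → ¬∀P λ { zero _ → P0 }
¬¬-∀≤ P (suc k) ¬¬P ¬∀P = ¬¬P 0 z≤n λ P0 →
  ¬¬-∀≤ (P ∘ suc) k (λ s s≤k → ¬¬P (suc s) (s≤s s≤k)) λ ∀P∘suc →
  ¬∀P λ { zero _ → P0 ; (suc s) (s≤s s≤k) → ∀P∘suc s s≤k }

Pair : ℕ → SetN
Pair h n = (n ≡ 0) ⊎ (n ≡ h)

Pair⊕Below≐Upto : ∀ {h k} → h + h ≡ suc k → (Pair h ⊕ (_< h)) ≐ Upto k
Pair⊕Below≐Upto {h} {k} h+h≡1+k = sum≤k , decompose
  where
  below-1+k : ∀ {n} → n < h + h → n ≤ k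
  below-1+k {n} n<h+h = ≤-pred (subst (n <_) h+h≡1+k n<h+h)

  sum≤k : (Pair h ⊕ (_< h)) ⊆ Upto k
  sum≤k (_ , y , inj₁ refl , y<h , refl) = below-1+k (≤-trans y<h (m≤n+m h h))
  sum≤k (_ , y , inj₂ refl , y<h , refl) = below-1+k (+-monoʳ-< h y<h)

  decompose : Upto k ⊆ (Pair h ⊕ (_< h))
  decompose {n} n≤k with n <? h
  ... | yes n<h = 0 , n , inj₁ refl , n<h , refl
  ... | no  n≮h = h , n ∸ h , inj₂ refl , n∸h<h , m+[n∸m]≡n h≤n
    where
    h≤n : h ≤ n
    h≤n = ≮⇒≥ n≮h
    n∸h<h : n ∸ h < h
    n∸h<h = +-cancelˡ-< h (n ∸ h) h
              (subst (_< h + h) (sym (m+[n∸m]≡n h≤n)) (subst (n <_) (sym h+h≡1+k) (s≤s n≤k)))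

⊕-≤-max : ∀ {B C mB mC n} → IsMax B mB → IsMax C mC → (B ⊕ C) n → n ≤ mB + mC
⊕-≤-max (_ , maxB) (_ , maxC) (b , c , Bb , Cc , refl) = +-mono-≤ (maxB b Bb) (maxC c Cc)

⊕≐-0∈ˡ : ∀ {B C A : SetN} → (B ⊕ C) ≐ A → A 0 → B 0
⊕≐-0∈ˡ {B} (_ , A⊆B⊕C) A0 with A⊆B⊕C A0
... | b , c , Bb , _ , b+c≡0 = subst B (m+n≡0⇒m≡0 b b+c≡0) Bb

⊕⊆Upto⇒b+b≤k : ∀ {B C k b mB mC} → (B ⊕ C) ⊆ Upto k → B b →
               IsMax B mB → IsMax C mC → mB ≤ mC → b + b ≤ k
⊕⊆Upto⇒b+b≤k {b = b} {mC = mC} B⊕C⊆Upto Bb (_ , maxB) (CmC , _) mB≤mC =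
  ≤-trans (+-monoʳ-≤ b (≤-trans (maxB b Bb) mB≤mC)) (B⊕C⊆Upto (b , mC , Bb , CmC , refl))

Promotion-of-0-contains-1 : ∀ {k A B C} → 1 ≤ k → (B ⊕ C) ≐ A →
                            IsMax B 0 → IsMax C 0 → Promotion k A B 0 1
Promotion-of-0-contains-1 1≤k (_ , A⊆B⊕C) maxB maxC =
  inj₂ (inj₂ (1 , 1≤k , (λ A1 → 1+n≰n (⊕-≤-max maxB maxC (A⊆B⊕C A1))) , z≤n , refl))

Promotion⊆Pair⇒¬¬A : ∀ {k A Y h m} → A 0 → A m → A (h + m) → m ≤ h →
                     Promotion k A Y m ⊆ Pair h → ∀ s → s ≤ k → ¬ ¬ A s
Promotion⊆Pair⇒¬¬A {A = A} {h = h} {m} A0 Am A[h+m] m≤h P⊆Pair s s≤k ¬As with s <? m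
... | yes s<m = case P⊆Pair (inj₂ (inj₁ (s≤k , ¬As , s<m))) of λ where
  (inj₁ refl) → ¬As A0
  (inj₂ refl) → <⇒≱ s<m m≤h
... | no s≮m = case P⊆Pair (inj₂ (inj₂ (s , s≤k , ¬As , ≮⇒≥ s≮m , refl))) of λ where
  (inj₁ s∸m≡0) → ¬As (subst A (≤-antisym (≮⇒≥ s≮m) (m∸n≡0⇒m≤n s∸m≡0)) Am)
  (inj₂ s∸m≡h) → ¬As (subst A (trans (cong (_+ m) (sym s∸m≡h)) (m∸n+n≡m (≮⇒≥ s≮m))) A[h+m])

mainTheorem14 : (k : ℕ) → 3 ≤ k → k % 2 ≡ 1 →
    (A : SetN) → A 0 → A ⊆ Upto k → ¬ (A ≐ Upto k) →
    AdditiveDivisor (Fk k) (Upto k)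
    × ((B : SetN) → AdditiveDivisor B A → ¬ InF k A B (Fk k))
mainTheorem14 k 3≤k k-odd A A0 A⊆Upto A≉Upto = (_ , Pair⊕Below≐Upto h+h≡1+k) , Fk∉F
  where
  h : ℕ
  h = suc k / 2
  h+h≡1+k : h + h ≡ suc k
  h+h≡1+k = half+half≡suc k-odd
  1≤k : 1 ≤ k
  1≤k = ≤-trans (s≤s z≤n) 3≤k

  Fk∉F : (B : SetN) → AdditiveDivisor B A → ¬ InF k A B (Fk k)
  Fk∉F B _ (inj₁ (Fk≐B , C , B⊕C≐A , _ , _ , maxB , maxC , mB≤mC)) =
    1+n≰n (subst (_≤ k) h+h≡1+k
      (⊕⊆Upto⇒b+b≤k (A⊆Upto ∘ proj₁ B⊕C≐A) (proj₁ Fk≐B (inj₂ refl)) maxB maxC mB≤mC))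
  Fk∉F B _ (inj₂ (C , B⊕C≐A@(B⊕C⊆A , _) , _ , mC , maxB@(BmB , _) , maxC@(CmC , _) , mC≤mB , Fk≐P))
    with proj₂ Fk≐P (inj₁ BmB) | mC≤mB
  ... | inj₁ refl | z≤n = case proj₂ Fk≐P (Promotion-of-0-contains-1 1≤k B⊕C≐A maxB maxC) of λ where
    (inj₁ ())
    (inj₂ 1≡h) → 1+n≰n (subst (2 ≤_) (sym 1≡h) (2≤half 3≤k))
  ... | inj₂ refl | _ = ¬¬-∀≤ A k (Promotion⊆Pair⇒¬¬A A0 A[0+mC] A[h+mC] mC≤mB (proj₂ Fk≐P))
                          λ ∀A → A≉Upto (A⊆Upto , ∀A _)
    where
    A[0+mC] : A mC
    A[0+mC] = B⊕C⊆A (0 , mC , ⊕≐-0∈ˡ B⊕C≐A A0 , CmC , refl)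
    A[h+mC] : A (h + mC)
    A[h+mC] = B⊕C⊆A (h , mC , BmB , CmC , refl)
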